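{- Let $m\ge 12$ and $n\ge 18$ be integers and let $T_{m,n}=C_m\Box C_n$. Then $\chi(T_{m,n}^2)\le 7$.
   Context: $C_k$ denotes the cycle on $k$ vertices; $\Box$ is the Cartesian product of graphs. The square $G^2$ of a graph $G$ has vertex set $V(G)$, two distinct vertices being adjacent iff their distance in $G$ is at most 2. $\chi$ is the chromatic number. -}

module Defs where

import Data.Nat
open import Data.Nat using (ℕ; NonZero)
open import Data.Nat.DivMod using (_%_)
open import Data.Fin using (Fin; toℕ)
open import Data.Product using (_×_; _,_; ∃)
open import Data.Sum using (_⊎_)
open import Relation.Binary.PropositionalEquality using (_≡_; _≢_)
open import Relation.Nullary using (¬_)

record Graph : Set₁ where
  field
    V   : Set
    Adj : V → V → Set
open Graph public

-- The cycle C_k on vertex set Z_k = Fin k: i ~ j iff j ≡ i+1 (mod k) or i ≡ j+1 (mod k).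
-- (For k ≥ 3 this is the usual simple cycle.)
Cycle : (k : ℕ) → .{{NonZero k}} → Graph
Cycle k = record
  { V   = Fin k
  ; Adj = λ i j → (toℕ j ≡ (Data.Nat.suc (toℕ i)) % k) ⊎ (toℕ i ≡ (Data.Nat.suc (toℕ j)) % k)
  }

_□_ : Graph → Graph → Graph
G □ H = record
  { V   = V G × V H
  ; Adj = λ { (g , h) (g′ , h′) →
              (Adj G g g′ × h ≡ h′) ⊎ (g ≡ g′ × Adj H h h′) }
  }

square : Graph → Graph
square G = record
  { V   = V G
  ; Adj = λ u v → u ≢ v × (Adj G u v ⊎ ∃ λ w → Adj G u w × Adj G w v)
  }

IsProperColouring : (G : Graph) (k : ℕ) → (V G → Fin k) → Set
IsProperColouring G k c = ∀ u v → Adj G u v → c u ≢ c v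

χ≤ : Graph → ℕ → Set
χ≤ G k = ∃ λ (c : V G → Fin k) → IsProperColouring G k c

Torus : (m n : ℕ) → .{{NonZero m}} → .{{NonZero n}} → Graph
Torus m n = Cycle m □ Cycle n

module Submission where

-- Colour the torus C_m □ C_n through a fixed finite pattern
-- F : R × K → Fin 7: row g of the torus is read through a closed walk ρ of
-- length m in a small digraph R of pattern rows, column h through a closed
-- walk γ of length n in a digraph K of pattern columns, and
-- colour (g , h) = F (ρ g) (γ h).  If F is locally proper (cells one or two
-- steps apart along R or along K, or one step apart along both, differ), this
-- properly colours the square of the torus (pattern-colouring).
-- R and K are block digraphs: the pattern is cut into blocks of consecutive
-- rows (columns), and after the last row of a block any block may follow.
-- Tour lengths (lengths of walks from a block start to every block start) are
-- closed under addition (tour-+) and yield closed walks (tour), so every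
-- m ≥ 12 is realised by row blocks of sizes 5, 6, 7, and every n ≥ 18 by
-- column blocks of sizes 5, 6 (first pattern, n ≠ 19) or 6, 13 (second
-- pattern, n = 19).  The finite facts (local properness of both patterns and
-- the short tour lengths) are decided by computation.

open import Defs
open import Data.Nat using (ℕ; zero; suc; _+_; _∸_; _<_; _≤_; _<?_; _≡ᵇ_; NonZero; s≤s)
open import Data.Nat.Properties using (≤∧≢⇒<; 0≢1+n; suc-injective; m+[n∸m]≡n)
  renaming (_≟_ to _≟ℕ_)
open import Data.Nat.DivMod using (_%_; n%n≡0; m<n⇒m%n≡m)
open import Data.Fin using (Fin; toℕ; fromℕ<; #_) renaming (_≟_ to _≟ᶠ_)
open import Data.Fin.Properties using (toℕ-injective; toℕ<n) renaming (all? to allFin?)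
open import Data.Bool using (if_then_else_)
open import Data.Maybe using (Maybe; just; nothing)
open import Data.List using (List; []; _∷_; mapMaybe)
open import Data.Bool.ListAction using (any)
open import Data.List.Relation.Unary.All as All using (All; all?)
open import Data.List.Relation.Unary.Any as Any using (Any; any?)
open import Data.List.Membership.Propositional using (_∈_; find; lose)
open import Data.Vec using (Vec; lookup; _∷_; [])
open import Data.Product as Product using (_×_; _,_; ∃; proj₁; proj₂)
open import Data.Sum as Sum using (_⊎_; inj₁; inj₂)
open import Data.Empty using (⊥-elim)
open import Relation.Nullary using (Dec; yes; no; ¬?; _×-dec_)
open import Relation.Nullary.Decidable using (True; toWitness; map′)
open import Relation.Binary.PropositionalEquality
  using (_≡_; _≢_; refl; sym; trans; cong; subst; ≢-sym; module ≡-Reasoning)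

data Path {S : Set} (Step : S → S → Set) : S → S → ℕ → Set where
  []  : ∀ {x} → Path Step x x 0
  _∷_ : ∀ {x y z n} → Step x y → Path Step y z n → Path Step x z (suc n)

infixr 5 _∷_ _++_

_++_ : ∀ {S : Set} {Step : S → S → Set} {x y z a b} →
       Path Step x y a → Path Step y z b → Path Step x z (a + b)
[]      ++ q = q
(s ∷ p) ++ q = s ∷ (p ++ q)

module _ {S : Set} {Step : S → S → Set} where

  -- The vertex visited after i steps (the end vertex once i exceeds the length).
  at : ∀ {x z n} → Path Step x z n → ℕ → S
  at {x = x} _       zero    = x
  at {x = x} []      (suc _) = x
  at         (_ ∷ p) (suc i) = at p i

  at-step : ∀ {x z n} (p : Path Step x z n) {i} → i < n → Step (at p i) (at p (suc i))
  at-step (s ∷ p) {zero}  _         = s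
  at-step (s ∷ p) {suc i} (s≤s i<n) = at-step p i<n

  at-end : ∀ {x z n} (p : Path Step x z n) → at p n ≡ z
  at-end []      = refl
  at-end (_ ∷ p) = at-end p

-- The directed cycle on Fin m: i → j iff j = i + 1 (mod m).  The cycle C_m of
-- Defs is its symmetric closure.
Next : (m : ℕ) .{{_ : NonZero m}} → Fin m → Fin m → Set
Next m i j = toℕ j ≡ suc (toℕ i) % m

suc-mod : ∀ {m i} .{{_ : NonZero m}} → i < m →
          (suc i ≡ m × suc i % m ≡ 0) ⊎ (suc i % m ≡ suc i)
suc-mod {m} {i} i<m with suc i ≟ℕ m
... | yes refl = inj₁ (refl , n%n≡0 (suc i))
... | no  i+1≢m = inj₂ (m<n⇒m%n≡m (≤∧≢⇒< i<m i+1≢m))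

suc-mod-injective : ∀ {m a b} .{{_ : NonZero m}} → a < m → b < m →
                    suc a % m ≡ suc b % m → a ≡ b
suc-mod-injective a<m b<m e with suc-mod a<m | suc-mod b<m
... | inj₁ (a+1≡m , _)  | inj₁ (b+1≡m , _)  = suc-injective (trans a+1≡m (sym b+1≡m))
... | inj₁ (_ , a+1↦0) | inj₂ b+1↦b+1     = ⊥-elim (0≢1+n (trans (sym a+1↦0) (trans e b+1↦b+1)))
... | inj₂ a+1↦a+1     | inj₁ (_ , b+1↦0) = ⊥-elim (0≢1+n (trans (sym b+1↦0) (trans (sym e) a+1↦a+1)))
... | inj₂ a+1↦a+1     | inj₂ b+1↦b+1     = suc-injective (trans (sym a+1↦a+1) (trans e b+1↦b+1))

straight : ∀ {m} .{{_ : NonZero m}} {i j l : Fin m} → i ≢ l →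
           Adj (Cycle m) i j → Adj (Cycle m) j l →
           (Next m i j × Next m j l) ⊎ (Next m l j × Next m j i)
straight i≢l (inj₁ i→j) (inj₁ j→l) = inj₁ (i→j , j→l)
straight i≢l (inj₂ j→i) (inj₂ l→j) = inj₂ (l→j , j→i)
straight {i = i} {l = l} i≢l (inj₁ i→j) (inj₂ l→j) =
  ⊥-elim (i≢l (toℕ-injective (suc-mod-injective (toℕ<n i) (toℕ<n l) (trans (sym i→j) l→j))))
straight i≢l (inj₂ j→i) (inj₁ j→l) = ⊥-elim (i≢l (toℕ-injective (trans j→i (sym j→l))))

-- A homomorphism from the directed m-cycle into a digraph, i.e. a closed walk
-- of length m read off position by position.
CycleHom : ∀ {S : Set} (Step : S → S → Set) (m : ℕ) .{{_ : NonZero m}} → (Fin m → S) → Set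
CycleHom Step m w = ∀ {i j} → Next m i j → Step (w i) (w j)

closed-walk⇒cycleHom : ∀ {S : Set} {Step : S → S → Set} {m} .{{_ : NonZero m}} {x} →
                       (p : Path Step x x m) → CycleHom Step m (λ i → at p (toℕ i))
closed-walk⇒cycleHom {Step = Step} {m} p {i} {j} i→j =
  subst (Step (at p (toℕ i))) (sym next-position) (at-step p (toℕ<n i))
  where
  open ≡-Reasoning
  next-position : at p (toℕ j) ≡ at p (suc (toℕ i))
  next-position with suc-mod (toℕ<n i)
  ... | inj₁ (i+1≡m , i+1↦0) = begin
    at p (toℕ j)       ≡⟨ cong (at p) (trans i→j i+1↦0) ⟩
    at p 0             ≡⟨ sym (at-end p) ⟩
    at p m             ≡⟨ cong (at p) (sym i+1≡m) ⟩
    at p (suc (toℕ i)) ∎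
  ... | inj₂ i+1↦i+1 = cong (at p) (trans i→j i+1↦i+1)

-- Exactly these pairs are adjacent in the square
-- of a torus coloured through the pattern.
record LocallyProper {SR SC : Set} {k : ℕ} (StepR : SR → SR → Set) (StepC : SC → SC → Set)
                     (F : SR → SC → Fin k) : Set where
  field
    row-step      : ∀ {r r′ c} → StepR r r′ → F r c ≢ F r′ c
    row-two-steps : ∀ {r r′ r″ c} → StepR r r′ → StepR r′ r″ → F r c ≢ F r″ c
    col-step      : ∀ {r c c′} → StepC c c′ → F r c ≢ F r c′
    col-two-steps : ∀ {r c c′ c″} → StepC c c′ → StepC c′ c″ → F r c ≢ F r c″
    diagonal      : ∀ {r r′ c c′} → StepR r r′ → StepC c c′ → F r c ≢ F r′ c′
    antidiagonal  : ∀ {r r′ c c′} → StepR r r′ → StepC c c′ → F r c′ ≢ F r′ c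

  row-step± : ∀ {r r′ c} → StepR r r′ ⊎ StepR r′ r → F r c ≢ F r′ c
  row-step± (inj₁ s) = row-step s
  row-step± (inj₂ s) = ≢-sym (row-step s)

  col-step± : ∀ {r c c′} → StepC c c′ ⊎ StepC c′ c → F r c ≢ F r c′
  col-step± (inj₁ s) = col-step s
  col-step± (inj₂ s) = ≢-sym (col-step s)

  row-two-steps± : ∀ {r r′ r″ c} → (StepR r r′ × StepR r′ r″) ⊎ (StepR r″ r′ × StepR r′ r) →
                   F r c ≢ F r″ c
  row-two-steps± (inj₁ (s , t)) = row-two-steps s t
  row-two-steps± (inj₂ (s , t)) = ≢-sym (row-two-steps s t)

  col-two-steps± : ∀ {r c c′ c″} → (StepC c c′ × StepC c′ c″) ⊎ (StepC c″ c′ × StepC c′ c) →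
                   F r c ≢ F r c″
  col-two-steps± (inj₁ (s , t)) = col-two-steps s t
  col-two-steps± (inj₂ (s , t)) = ≢-sym (col-two-steps s t)

  diagonal± : ∀ {r r′ c c′} → StepR r r′ ⊎ StepR r′ r → StepC c c′ ⊎ StepC c′ c → F r c ≢ F r′ c′
  diagonal± (inj₁ s) (inj₁ t) = diagonal s t
  diagonal± (inj₁ s) (inj₂ t) = antidiagonal s t
  diagonal± (inj₂ s) (inj₁ t) = ≢-sym (antidiagonal s t)
  diagonal± (inj₂ s) (inj₂ t) = ≢-sym (diagonal s t)

module _ {S : Set} {Step : S → S → Set} {m : ℕ} .{{_ : NonZero m}} {w : Fin m → S}
         (hom : CycleHom Step m w) where

  hom-step : ∀ {i j} → Adj (Cycle m) i j → Step (w i) (w j) ⊎ Step (w j) (w i)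
  hom-step = Sum.map hom hom

  hom-straight : ∀ {i j l} → i ≢ l → Adj (Cycle m) i j → Adj (Cycle m) j l →
                 (Step (w i) (w j) × Step (w j) (w l)) ⊎ (Step (w l) (w j) × Step (w j) (w i))
  hom-straight i≢l e₁ e₂ = Sum.map (Product.map hom hom) (Product.map hom hom) (straight i≢l e₁ e₂)

module _ {SR SC : Set} {k : ℕ} {StepR : SR → SR → Set} {StepC : SC → SC → Set}
         {F : SR → SC → Fin k} (lp : LocallyProper StepR StepC F)
         {m n : ℕ} .{{_ : NonZero m}} .{{_ : NonZero n}} {ρ : Fin m → SR} {γ : Fin n → SC}
         (ρ-hom : CycleHom StepR m ρ) (γ-hom : CycleHom StepC n γ) where
  open LocallyProper lp

  torusColour : Fin m × Fin n → Fin k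
  torusColour (g , h) = F (ρ g) (γ h)

  row-move : ∀ {g g′} → Adj (Cycle m) g g′ → StepR (ρ g) (ρ g′) ⊎ StepR (ρ g′) (ρ g)
  row-move = hom-step {Step = StepR} {w = ρ} ρ-hom

  col-move : ∀ {h h′} → Adj (Cycle n) h h′ → StepC (γ h) (γ h′) ⊎ StepC (γ h′) (γ h)
  col-move = hom-step {Step = StepC} {w = γ} γ-hom

  row-straight : ∀ {g g₁ g₂} → g ≢ g₂ → Adj (Cycle m) g g₁ → Adj (Cycle m) g₁ g₂ →
                 (StepR (ρ g) (ρ g₁) × StepR (ρ g₁) (ρ g₂)) ⊎ (StepR (ρ g₂) (ρ g₁) × StepR (ρ g₁) (ρ g))
  row-straight = hom-straight {Step = StepR} {w = ρ} ρ-hom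

  col-straight : ∀ {h h₁ h₂} → h ≢ h₂ → Adj (Cycle n) h h₁ → Adj (Cycle n) h₁ h₂ →
                 (StepC (γ h) (γ h₁) × StepC (γ h₁) (γ h₂)) ⊎ (StepC (γ h₂) (γ h₁) × StepC (γ h₁) (γ h))
  col-straight = hom-straight {Step = StepC} {w = γ} γ-hom

  one-step : ∀ u v → Adj (Torus m n) u v → torusColour u ≢ torusColour v
  one-step (g , h) (g′ , .h) (inj₁ (e , refl)) = row-step± (row-move e)
  one-step (g , h) (.g , h′) (inj₂ (refl , e)) = col-step± (col-move e)

  two-steps : ∀ u w v → u ≢ v → Adj (Torus m n) u w → Adj (Torus m n) w v →
              torusColour u ≢ torusColour v
  two-steps (g , h) (g₁ , .h) (g₂ , .h) u≢v (inj₁ (e₁ , refl)) (inj₁ (e₂ , refl)) =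
    row-two-steps± (row-straight (λ g≡g₂ → u≢v (cong (_, h) g≡g₂)) e₁ e₂)
  two-steps (g , h) (.g , h₁) (.g , h₂) u≢v (inj₂ (refl , e₁)) (inj₂ (refl , e₂)) =
    col-two-steps± (col-straight (λ h≡h₂ → u≢v (cong (g ,_) h≡h₂)) e₁ e₂)
  two-steps (g , h) (g₁ , .h) (.g₁ , h₂) _ (inj₁ (e₁ , refl)) (inj₂ (refl , e₂)) =
    diagonal± (row-move e₁) (col-move e₂)
  two-steps (g , h) (.g , h₁) (g₂ , .h₁) _ (inj₂ (refl , e₁)) (inj₁ (e₂ , refl)) =
    diagonal± (row-move e₂) (col-move e₁)

  pattern-colouring : IsProperColouring (square (Torus m n)) k torusColour
  pattern-colouring u v (u≢v , inj₁ e)              = one-step u v e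
  pattern-colouring u v (u≢v , inj₂ (w , e₁ , e₂)) = two-steps u w v u≢v e₁ e₂

module SuccessorDigraph {N : ℕ} (succ : Fin N → List (Fin N)) where

  Step : Fin N → Fin N → Set
  Step x y = y ∈ succ x

  path? : ∀ n x z → Dec (Path Step x z n)
  path? zero    x z = map′ (λ { refl → [] }) (λ { [] → refl }) (x ≟ᶠ z)
  path? (suc n) x z = map′ (λ via → let y , x→y , p = find via in x→y ∷ p)
                           (λ { (x→y ∷ p) → lose x→y p })
                           (any? (λ y → path? n y z) (succ x))

  -- Composing at a hub shows that tour lengths are
  -- closed under addition, and every tour length is the length of a closed walk.
  module Tours (hubs : List (Fin N)) where

    Reach : Fin N → ℕ → Set
    Reach x n = All (λ z → Path Step x z n) hubs

    TourLength : ℕ → Set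
    TourLength n = Any (λ x → Reach x n) hubs

    tour : ∀ {n} → TourLength n → ∃ λ x → Path Step x x n
    tour t = let x , x∈hubs , reach = find t in x , All.lookup reach x∈hubs

    tour-+ : ∀ {a b} → TourLength a → TourLength b → TourLength (a + b)
    tour-+ ta tb =
      let y , y∈hubs , reach-b = find tb
      in  Any.map (λ reach-a → All.map (All.lookup reach-a y∈hubs ++_) reach-b) ta

    tourLength? : ∀ n → Dec (TourLength n)
    tourLength? n = any? (λ x → all? (path? n x) hubs) hubs

    decide-tour : ∀ n → {True (tourLength? n)} → TourLength n
    decide-tour n {certificate} = toWitness certificate

-- Local properness of a pattern on two successor digraphs, cell by cell: the
-- condition at cell (r , c) covers all pairs whose first cell is (r , c).
module PatternCheck {NR NC k : ℕ} (succR : Fin NR → List (Fin NR)) (succC : Fin NC → List (Fin NC))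
                    (F : Fin NR → Fin NC → Fin k) where

  open SuccessorDigraph succR using () renaming (Step to StepR)
  open SuccessorDigraph succC using () renaming (Step to StepC)


  RowNeighbourOK : Fin NR → Fin NC → Fin NR → Set
  RowNeighbourOK r c r′ =
    F r c ≢ F r′ c ×
    All (λ r″ → F r c ≢ F r″ c) (succR r′) ×
    All (λ c′ → F r c ≢ F r′ c′ × F r c′ ≢ F r′ c) (succC c)

  ColNeighbourOK : Fin NR → Fin NC → Fin NC → Set
  ColNeighbourOK r c c′ =
    F r c ≢ F r c′ × All (λ c″ → F r c ≢ F r c″) (succC c′)

  CellOK : Fin NR → Fin NC → Set
  CellOK r c = All (RowNeighbourOK r c) (succR r) × All (ColNeighbourOK r c) (succC c)

  distinct? : (a b : Fin k) → Dec (a ≢ b)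
  distinct? a b = ¬? (a ≟ᶠ b)

  cellsOK? : Dec (∀ r c → CellOK r c)
  cellsOK? = allFin? λ r → allFin? λ c →
    all? (λ r′ → distinct? _ _ ×-dec all? (λ r″ → distinct? _ _) (succR r′)
                 ×-dec all? (λ c′ → distinct? _ _ ×-dec distinct? _ _) (succC c)) (succR r)
    ×-dec all? (λ c′ → distinct? _ _ ×-dec all? (λ c″ → distinct? _ _) (succC c′)) (succC c)

  cellsOK⇒locallyProper : (∀ r c → CellOK r c) → LocallyProper StepR StepC F
  cellsOK⇒locallyProper ok = record
    { row-step      = λ r→r′ → proj₁ (row r→r′)
    ; row-two-steps = λ r→r′ r′→r″ → All.lookup (proj₁ (proj₂ (row r→r′))) r′→r″
    ; col-step      = λ c→c′ → proj₁ (col c→c′)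
    ; col-two-steps = λ c→c′ c′→c″ → All.lookup (proj₂ (col c→c′)) c′→c″
    ; diagonal      = λ r→r′ c→c′ → proj₁ (All.lookup (proj₂ (proj₂ (row r→r′))) c→c′)
    ; antidiagonal  = λ r→r′ c→c′ → proj₂ (All.lookup (proj₂ (proj₂ (row r→r′))) c→c′)
    }
    where
    row : ∀ {r r′ c} → StepR r r′ → RowNeighbourOK r c r′
    row {r} {c = c} r→r′ = All.lookup (proj₁ (ok r c)) r→r′
    col : ∀ {r c c′} → StepC c c′ → ColNeighbourOK r c c′
    col {r} {c} c→c′ = All.lookup (proj₂ (ok r c)) c→c′

  decide-locallyProper : {True cellsOK?} → LocallyProper StepR StepC F
  decide-locallyProper {certificate} = cellsOK⇒locallyProper (toWitness certificate)

-- Block digraphs: the vertices 0, …, N-1 are cut into blocks of consecutive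
-- vertices beginning at the given starts (which include 0).  Inside a block
-- the walk moves to the next vertex; from the last vertex of a block it may
-- jump to the start of any block.  The block starts are the hubs of tours, and
-- a block of length ℓ gives tour length ℓ.
module BlockDigraph (N : ℕ) (starts : List ℕ) where

  toFin? : ℕ → Maybe (Fin N)
  toFin? i with i <? N
  ... | yes i<N = just (fromℕ< i<N)
  ... | no  _   = nothing

  fins : List ℕ → List (Fin N)
  fins = mapMaybe toFin?

  blockSucc : Fin N → List (Fin N)
  blockSucc r = fins (if any (suc (toℕ r) ≡ᵇ_) (N ∷ starts) then starts else suc (toℕ r) ∷ [])

  open SuccessorDigraph blockSucc public
  open Tours (fins starts) public

-- The pattern rows: blocks of 5, 6 and 7 rows.
module Rows = BlockDigraph 18 (0 ∷ 5 ∷ 11 ∷ [])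

-- First column scheme: blocks of 5 and 6 columns.
module Cols₁ = BlockDigraph 11 (0 ∷ 5 ∷ [])

-- Second column scheme: blocks of 6 and 13 columns.
module Cols₂ = BlockDigraph 19 (0 ∷ 6 ∷ [])

pattern₁ : Vec (Vec (Fin 7) 11) 18
pattern₁ =
    (# 0 ∷ # 3 ∷ # 2 ∷ # 4 ∷ # 1 ∷ # 0 ∷ # 3 ∷ # 1 ∷ # 2 ∷ # 4 ∷ # 1 ∷ []) ∷
    (# 4 ∷ # 1 ∷ # 0 ∷ # 3 ∷ # 2 ∷ # 4 ∷ # 5 ∷ # 0 ∷ # 3 ∷ # 5 ∷ # 2 ∷ []) ∷
    (# 3 ∷ # 2 ∷ # 4 ∷ # 1 ∷ # 0 ∷ # 3 ∷ # 6 ∷ # 2 ∷ # 4 ∷ # 6 ∷ # 0 ∷ []) ∷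
    (# 1 ∷ # 0 ∷ # 3 ∷ # 2 ∷ # 4 ∷ # 1 ∷ # 0 ∷ # 3 ∷ # 1 ∷ # 2 ∷ # 4 ∷ []) ∷
    (# 2 ∷ # 4 ∷ # 1 ∷ # 0 ∷ # 3 ∷ # 2 ∷ # 4 ∷ # 5 ∷ # 6 ∷ # 0 ∷ # 3 ∷ []) ∷
    (# 0 ∷ # 3 ∷ # 2 ∷ # 4 ∷ # 1 ∷ # 0 ∷ # 3 ∷ # 1 ∷ # 2 ∷ # 4 ∷ # 1 ∷ []) ∷
    (# 4 ∷ # 5 ∷ # 0 ∷ # 3 ∷ # 2 ∷ # 4 ∷ # 5 ∷ # 0 ∷ # 3 ∷ # 5 ∷ # 2 ∷ []) ∷
    (# 3 ∷ # 1 ∷ # 4 ∷ # 6 ∷ # 0 ∷ # 3 ∷ # 1 ∷ # 2 ∷ # 4 ∷ # 1 ∷ # 0 ∷ []) ∷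
    (# 6 ∷ # 2 ∷ # 3 ∷ # 1 ∷ # 5 ∷ # 2 ∷ # 4 ∷ # 5 ∷ # 0 ∷ # 3 ∷ # 5 ∷ []) ∷
    (# 1 ∷ # 0 ∷ # 5 ∷ # 2 ∷ # 4 ∷ # 1 ∷ # 0 ∷ # 3 ∷ # 1 ∷ # 2 ∷ # 4 ∷ []) ∷
    (# 2 ∷ # 4 ∷ # 1 ∷ # 0 ∷ # 3 ∷ # 5 ∷ # 2 ∷ # 4 ∷ # 5 ∷ # 0 ∷ # 3 ∷ []) ∷
    (# 0 ∷ # 3 ∷ # 2 ∷ # 4 ∷ # 1 ∷ # 0 ∷ # 3 ∷ # 1 ∷ # 2 ∷ # 4 ∷ # 1 ∷ []) ∷
    (# 4 ∷ # 1 ∷ # 5 ∷ # 6 ∷ # 2 ∷ # 4 ∷ # 5 ∷ # 0 ∷ # 3 ∷ # 5 ∷ # 2 ∷ []) ∷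
    (# 6 ∷ # 2 ∷ # 4 ∷ # 0 ∷ # 5 ∷ # 6 ∷ # 1 ∷ # 4 ∷ # 6 ∷ # 0 ∷ # 3 ∷ []) ∷
    (# 0 ∷ # 5 ∷ # 6 ∷ # 3 ∷ # 1 ∷ # 0 ∷ # 3 ∷ # 5 ∷ # 2 ∷ # 4 ∷ # 1 ∷ []) ∷
    (# 3 ∷ # 1 ∷ # 0 ∷ # 5 ∷ # 6 ∷ # 2 ∷ # 4 ∷ # 6 ∷ # 0 ∷ # 5 ∷ # 6 ∷ []) ∷
    (# 5 ∷ # 6 ∷ # 3 ∷ # 2 ∷ # 4 ∷ # 1 ∷ # 0 ∷ # 3 ∷ # 1 ∷ # 2 ∷ # 4 ∷ []) ∷
    (# 2 ∷ # 4 ∷ # 1 ∷ # 0 ∷ # 3 ∷ # 5 ∷ # 2 ∷ # 4 ∷ # 5 ∷ # 0 ∷ # 3 ∷ []) ∷ []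

pattern₂ : Vec (Vec (Fin 7) 19) 18
pattern₂ =
    (# 0 ∷ # 3 ∷ # 1 ∷ # 2 ∷ # 4 ∷ # 1 ∷ # 0 ∷ # 4 ∷ # 2 ∷ # 3 ∷ # 1 ∷ # 2 ∷ # 5 ∷ # 4 ∷ # 0 ∷ # 3 ∷ # 2 ∷ # 4 ∷ # 1 ∷ []) ∷
    (# 4 ∷ # 5 ∷ # 0 ∷ # 3 ∷ # 5 ∷ # 2 ∷ # 3 ∷ # 5 ∷ # 1 ∷ # 4 ∷ # 5 ∷ # 3 ∷ # 0 ∷ # 2 ∷ # 5 ∷ # 1 ∷ # 0 ∷ # 5 ∷ # 2 ∷ []) ∷
    (# 1 ∷ # 6 ∷ # 2 ∷ # 4 ∷ # 6 ∷ # 0 ∷ # 1 ∷ # 2 ∷ # 6 ∷ # 0 ∷ # 2 ∷ # 1 ∷ # 4 ∷ # 6 ∷ # 3 ∷ # 2 ∷ # 4 ∷ # 3 ∷ # 0 ∷ []) ∷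
    (# 5 ∷ # 0 ∷ # 3 ∷ # 1 ∷ # 2 ∷ # 4 ∷ # 5 ∷ # 3 ∷ # 4 ∷ # 1 ∷ # 3 ∷ # 6 ∷ # 2 ∷ # 5 ∷ # 1 ∷ # 0 ∷ # 5 ∷ # 2 ∷ # 4 ∷ []) ∷
    (# 2 ∷ # 4 ∷ # 6 ∷ # 5 ∷ # 0 ∷ # 3 ∷ # 2 ∷ # 1 ∷ # 0 ∷ # 5 ∷ # 4 ∷ # 0 ∷ # 1 ∷ # 3 ∷ # 2 ∷ # 4 ∷ # 1 ∷ # 0 ∷ # 3 ∷ []) ∷
    (# 0 ∷ # 3 ∷ # 1 ∷ # 2 ∷ # 4 ∷ # 1 ∷ # 0 ∷ # 4 ∷ # 2 ∷ # 3 ∷ # 1 ∷ # 2 ∷ # 4 ∷ # 0 ∷ # 5 ∷ # 3 ∷ # 2 ∷ # 4 ∷ # 1 ∷ []) ∷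
    (# 4 ∷ # 5 ∷ # 0 ∷ # 3 ∷ # 5 ∷ # 2 ∷ # 3 ∷ # 5 ∷ # 1 ∷ # 4 ∷ # 0 ∷ # 3 ∷ # 5 ∷ # 2 ∷ # 4 ∷ # 1 ∷ # 0 ∷ # 5 ∷ # 2 ∷ []) ∷
    (# 3 ∷ # 1 ∷ # 6 ∷ # 4 ∷ # 1 ∷ # 0 ∷ # 4 ∷ # 2 ∷ # 3 ∷ # 6 ∷ # 2 ∷ # 4 ∷ # 1 ∷ # 3 ∷ # 0 ∷ # 5 ∷ # 4 ∷ # 1 ∷ # 0 ∷ []) ∷
    (# 6 ∷ # 2 ∷ # 5 ∷ # 0 ∷ # 3 ∷ # 5 ∷ # 1 ∷ # 0 ∷ # 5 ∷ # 1 ∷ # 3 ∷ # 5 ∷ # 0 ∷ # 4 ∷ # 1 ∷ # 2 ∷ # 6 ∷ # 3 ∷ # 5 ∷ []) ∷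
    (# 1 ∷ # 0 ∷ # 3 ∷ # 1 ∷ # 2 ∷ # 4 ∷ # 6 ∷ # 3 ∷ # 4 ∷ # 2 ∷ # 6 ∷ # 1 ∷ # 2 ∷ # 5 ∷ # 3 ∷ # 0 ∷ # 5 ∷ # 2 ∷ # 4 ∷ []) ∷
    (# 2 ∷ # 4 ∷ # 6 ∷ # 5 ∷ # 0 ∷ # 3 ∷ # 2 ∷ # 1 ∷ # 0 ∷ # 5 ∷ # 4 ∷ # 0 ∷ # 3 ∷ # 1 ∷ # 2 ∷ # 4 ∷ # 1 ∷ # 0 ∷ # 3 ∷ []) ∷
    (# 0 ∷ # 3 ∷ # 1 ∷ # 2 ∷ # 4 ∷ # 1 ∷ # 0 ∷ # 4 ∷ # 2 ∷ # 3 ∷ # 1 ∷ # 2 ∷ # 4 ∷ # 0 ∷ # 5 ∷ # 3 ∷ # 2 ∷ # 4 ∷ # 1 ∷ []) ∷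
    (# 4 ∷ # 5 ∷ # 0 ∷ # 3 ∷ # 5 ∷ # 2 ∷ # 3 ∷ # 5 ∷ # 1 ∷ # 4 ∷ # 0 ∷ # 3 ∷ # 5 ∷ # 2 ∷ # 1 ∷ # 0 ∷ # 5 ∷ # 6 ∷ # 2 ∷ []) ∷
    (# 1 ∷ # 2 ∷ # 6 ∷ # 4 ∷ # 0 ∷ # 6 ∷ # 1 ∷ # 0 ∷ # 6 ∷ # 2 ∷ # 5 ∷ # 1 ∷ # 6 ∷ # 4 ∷ # 3 ∷ # 6 ∷ # 1 ∷ # 0 ∷ # 5 ∷ []) ∷
    (# 0 ∷ # 4 ∷ # 1 ∷ # 2 ∷ # 3 ∷ # 5 ∷ # 2 ∷ # 4 ∷ # 5 ∷ # 3 ∷ # 4 ∷ # 2 ∷ # 3 ∷ # 1 ∷ # 0 ∷ # 5 ∷ # 4 ∷ # 3 ∷ # 6 ∷ []) ∷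
    (# 3 ∷ # 6 ∷ # 5 ∷ # 0 ∷ # 6 ∷ # 1 ∷ # 0 ∷ # 6 ∷ # 2 ∷ # 0 ∷ # 1 ∷ # 6 ∷ # 0 ∷ # 5 ∷ # 4 ∷ # 2 ∷ # 6 ∷ # 5 ∷ # 1 ∷ []) ∷
    (# 5 ∷ # 0 ∷ # 3 ∷ # 1 ∷ # 2 ∷ # 4 ∷ # 5 ∷ # 3 ∷ # 4 ∷ # 6 ∷ # 3 ∷ # 5 ∷ # 2 ∷ # 6 ∷ # 1 ∷ # 0 ∷ # 3 ∷ # 2 ∷ # 4 ∷ []) ∷
    (# 2 ∷ # 4 ∷ # 6 ∷ # 5 ∷ # 0 ∷ # 3 ∷ # 2 ∷ # 1 ∷ # 0 ∷ # 5 ∷ # 4 ∷ # 0 ∷ # 1 ∷ # 3 ∷ # 2 ∷ # 4 ∷ # 1 ∷ # 0 ∷ # 3 ∷ []) ∷ []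

entry : ∀ {k NR NC} → Vec (Vec (Fin k) NC) NR → Fin NR → Fin NC → Fin k
entry table r c = lookup (lookup table r) c

pattern₁-locallyProper : LocallyProper Rows.Step Cols₁.Step (entry pattern₁)
pattern₁-locallyProper = PatternCheck.decide-locallyProper Rows.blockSucc Cols₁.blockSucc (entry pattern₁)

pattern₂-locallyProper : LocallyProper Rows.Step Cols₂.Step (entry pattern₂)
pattern₂-locallyProper = PatternCheck.decide-locallyProper Rows.blockSucc Cols₂.blockSucc (entry pattern₂)

rowTour : ∀ j → Rows.TourLength (12 + j)
rowTour 0 = Rows.decide-tour 12
rowTour 1 = Rows.decide-tour 13
rowTour 2 = Rows.decide-tour 14
rowTour 3 = Rows.decide-tour 15
rowTour 4 = Rows.decide-tour 16
rowTour (suc (suc (suc (suc (suc j))))) = Rows.tour-+ (Rows.decide-tour 5) (rowTour j)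

colTour₁ : ∀ j → Cols₁.TourLength (20 + j)
colTour₁ 0 = Cols₁.decide-tour 20
colTour₁ 1 = Cols₁.decide-tour 21
colTour₁ 2 = Cols₁.decide-tour 22
colTour₁ 3 = Cols₁.decide-tour 23
colTour₁ 4 = Cols₁.decide-tour 24
colTour₁ (suc (suc (suc (suc (suc j))))) = Cols₁.tour-+ (Cols₁.decide-tour 5) (colTour₁ j)

torus-colouring :
  ∀ {SR SC : Set} {k} {StepR : SR → SR → Set} {StepC : SC → SC → Set} {F : SR → SC → Fin k} →
  LocallyProper StepR StepC F → ∀ {m n} .{{_ : NonZero m}} .{{_ : NonZero n}} →
  (∃ λ x → Path StepR x x m) → (∃ λ y → Path StepC y y n) → χ≤ (square (Torus m n)) k
torus-colouring lp (_ , p) (_ , q) =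
  torusColour lp (closed-walk⇒cycleHom p) (closed-walk⇒cycleHom q) ,
  pattern-colouring lp (closed-walk⇒cycleHom p) (closed-walk⇒cycleHom q)

corollary1 : (m n : ℕ) → 12 ≤ m → 18 ≤ n → .{{_ : NonZero m}} → .{{_ : NonZero n}} →
    χ≤ (square (Torus m n)) 7
corollary1 m n 12≤m 18≤n = by-columns (n ∸ 18) (m+[n∸m]≡n 18≤n)
  where
  rows : ∃ λ x → Path Rows.Step x x m
  rows = Rows.tour (subst Rows.TourLength (m+[n∸m]≡n 12≤m) (rowTour (m ∸ 12)))

  by-columns : ∀ j → 18 + j ≡ n → χ≤ (square (Torus m n)) 7
  by-columns 0 n≡18 =
    torus-colouring pattern₁-locallyProper rows (Cols₁.tour (subst Cols₁.TourLength n≡18 (Cols₁.decide-tour 18)))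
  by-columns 1 n≡19 =
    torus-colouring pattern₂-locallyProper rows (Cols₂.tour (subst Cols₂.TourLength n≡19 (Cols₂.decide-tour 19)))
  by-columns (suc (suc j)) n≡20+j =
    torus-colouring pattern₁-locallyProper rows (Cols₁.tour (subst Cols₁.TourLength n≡20+j (colTour₁ j)))
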